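{- If $n,m\ge 2$, then $\mu_{\rm t}(K_n\,\square\,K_m)=\max\{n,m\}$.
   Context: $K_n$ is the complete graph on $n$ vertices. The Cartesian product $G\,\square\,H$ has vertex set $V(G)\times V(H)$, with $(g,h)$ adjacent to $(g',h')$ iff either $gg'\in E(G)$ and $h=h'$, or $g=g'$ and $hh'\in E(H)$. For a connected graph $G$ and $X\subseteq V(G)$, two vertices $x,y$ are $X$-visible if there is a shortest $x,y$-path $P$ with $V(P)\cap X\subseteq\{x,y\}$; $X$ is a total mutual-visibility set if every pair of vertices of $G$ is $X$-visible. $\mu_{\rm t}(G)$ is the largest cardinality of a total mutual-visibility set of $G$. -}

module Defs where

open import Level using (Level)
open import Data.Nat using (ℕ; zero; suc; _≤_)
open import Data.Fin using (Fin)
open import Data.Product using (_×_; Σ; ∃; ∃-syntax)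
open import Data.Sum using (_⊎_)
open import Data.List using (List; length)
open import Data.List.Membership.Propositional using (_∈_)
open import Data.List.Relation.Unary.Unique.Propositional using (Unique)
open import Relation.Binary.PropositionalEquality using (_≡_; _≢_)

record Graph : Set₁ where
  field
    V   : Set
    Adj : V → V → Set

open Graph public

K : ℕ → Graph
K n = record { V = Fin n ; Adj = λ i j → i ≢ j }

_□_ : Graph → Graph → Graph
G □ H = record
  { V   = V G × V H
  ; Adj = λ p q → (Adj G (Data.Product.proj₁ p) (Data.Product.proj₁ q) × Data.Product.proj₂ p ≡ Data.Product.proj₂ q)
                ⊎ (Data.Product.proj₁ p ≡ Data.Product.proj₁ q × Adj H (Data.Product.proj₂ p) (Data.Product.proj₂ q))
  }

data Walk (G : Graph) : V G → V G → ℕ → Set where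
  []  : ∀ {x} → Walk G x x 0
  _∷_ : ∀ {x y z k} → Adj G x y → Walk G y z k → Walk G x z (suc k)

data OnWalk (G : Graph) (v : V G) : ∀ {x y k} → Walk G x y k → Set where
  here-nil  : OnWalk G v {v} {v} []
  here-cons : ∀ {y z k} (e : Adj G v y) (w : Walk G y z k) → OnWalk G v (e ∷ w)
  there     : ∀ {x y z k} (e : Adj G x y) {w : Walk G y z k} → OnWalk G v w → OnWalk G v (e ∷ w)

IsShortest : (G : Graph) {x y : V G} {k : ℕ} → Walk G x y k → Set
IsShortest G {x} {y} {k} _ = ∀ j → Walk G x y j → k ≤ j

-- Vertex sets X are finite lists without repetition; |X| = length X.
-- x and y are X-visible: some shortest x,y-path P has V(P) ∩ X ⊆ {x, y}.
Visible : (G : Graph) → List (V G) → V G → V G → Set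
Visible G X x y =
  ∃[ k ] Σ (Walk G x y k) λ P →
    IsShortest G P × (∀ v → OnWalk G v P → v ∈ X → (v ≡ x ⊎ v ≡ y))

TotalMutualVisibility : (G : Graph) → List (V G) → Set
TotalMutualVisibility G X = Unique X × (∀ x y → Visible G X x y)

IsMuT : Graph → ℕ → Set
IsMuT G t =
  (∃[ X ] (TotalMutualVisibility G X × length X ≡ t)) ×
  (∀ X → TotalMutualVisibility G X → length X ≤ t)

-- In K_n □ K_m two vertices are at distance 2 exactly when they differ in both
-- coordinates, and the only shortest paths between them run through the two
-- "corners" (x₁ , y₂) and (y₁ , x₂).  Hence X is a total mutual-visibility set
-- iff no two of its vertices differ in both coordinates: for a and b in X the
-- vertices (a₁ , b₂) and (b₁ , a₂) have exactly a and b as corners, and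
-- conversely the two corners of a pair differ in both coordinates, so they
-- cannot both lie in X.  A set of pairwise aligned vertices lies in a single
-- row or column, so |X| ≤ max{n, m}, and a whole row or column attains this.
module Submission where

open import Defs
open import Data.Nat using (ℕ; _≤_; _≤?_; _⊔_; z≤n; s≤s)
open import Data.Nat.Properties using (≤-total; ≤-trans; ≰⇒>; m≤m⊔n; m≤n⊔m; m≥n⇒m⊔n≡m; m≤n⇒m⊔n≡n)
open import Data.Fin using (Fin; zero; suc; _≟_)
open import Data.Fin.Properties using (pigeonhole; <⇒≢)
open import Data.Product.Properties using (≡-dec)
open import Data.Product using (_×_; _,_; proj₁; proj₂; ∃-syntax)
open import Data.Sum using (_⊎_; inj₁; inj₂; [_,_]; swap)
open import Data.Empty using (⊥-elim)
open import Data.List using (List; []; _∷_; length; lookup; tabulate)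
open import Data.List.Properties using (length-tabulate)
open import Data.List.Membership.Propositional using (_∈_; _∉_; find)
import Data.List.Membership.DecPropositional as DecMembership
open import Data.List.Membership.Propositional.Properties using (∈-lookup; ∈-tabulate⁻)
open import Data.List.Relation.Unary.Any using (here)
open import Data.List.Relation.Unary.All as All using (all?)
open import Data.List.Relation.Unary.All.Properties using (¬All⇒Any¬)
open import Data.List.Relation.Unary.AllPairs using (_∷_)
open import Data.List.Relation.Unary.Unique.Propositional using (Unique)
open import Data.List.Relation.Unary.Unique.Propositional.Properties using (tabulate⁺)
open import Relation.Nullary using (¬_; yes; no; _⊎-dec_)
open import Relation.Binary.Definitions using (DecidableEquality)
open import Relation.Binary.PropositionalEquality using (_≡_; _≢_; refl; sym; trans; cong; cong₂; subst)
open import Function using (_∘_)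

lookup-injective : ∀ {A : Set} {xs : List A} → Unique xs →
                   ∀ i j → lookup xs i ≡ lookup xs j → i ≡ j
lookup-injective (_ ∷ _)     zero     zero     _  = refl
lookup-injective (x∉xs ∷ _)  zero     (suc j)  eq = ⊥-elim (All.lookup x∉xs (∈-lookup j) eq)
lookup-injective (x∉xs ∷ _)  (suc i)  zero     eq = ⊥-elim (All.lookup x∉xs (∈-lookup i) (sym eq))
lookup-injective (_ ∷ uniq)  (suc i)  (suc j)  eq = cong suc (lookup-injective uniq i j eq)

length≤-ofInjectiveOn : ∀ {A : Set} {k : ℕ} {xs : List A} (f : A → Fin k) → Unique xs →
                        (∀ {a b} → a ∈ xs → b ∈ xs → f a ≡ f b → a ≡ b) → length xs ≤ k
length≤-ofInjectiveOn {k = k} {xs} f uniq inj with length xs ≤? k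
... | yes xs≤k = xs≤k
... | no xs≰k with pigeonhole (≰⇒> xs≰k) (λ i → f (lookup xs i))
... | i , j , i<j , fᵢ≡fⱼ =
  ⊥-elim (<⇒≢ i<j (lookup-injective uniq i j (inj (∈-lookup i) (∈-lookup j) fᵢ≡fⱼ)))

module _ {A B : Set} where

  Aligned : A × B → A × B → Set
  Aligned a b = proj₁ a ≡ proj₁ b ⊎ proj₂ a ≡ proj₂ b

  aligned-sym : ∀ {a b} → Aligned a b → Aligned b a
  aligned-sym (inj₁ a₁≡b₁) = inj₁ (sym a₁≡b₁)
  aligned-sym (inj₂ a₂≡b₂) = inj₂ (sym a₂≡b₂)

  PairwiseAligned : List (A × B) → Set
  PairwiseAligned X = ∀ {a b} → a ∈ X → b ∈ X → Aligned a b

  AllSame : ∀ {C : Set} → (A × B → C) → List (A × B) → Set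
  AllSame f X = ∀ {a b} → a ∈ X → b ∈ X → f a ≡ f b

  Collinear : List (A × B) → Set
  Collinear X = AllSame proj₁ X ⊎ AllSame proj₂ X

  pairwiseAligned⇒collinear : DecidableEquality B → ∀ X → PairwiseAligned X → Collinear X
  pairwiseAligned⇒collinear _ [] _ = inj₁ λ ()
  pairwiseAligned⇒collinear _≟B_ X@(a ∷ _) aligned with all? (λ c → proj₂ c ≟B proj₂ a) X
  ... | yes inColumn = inj₂ λ c∈X d∈X → trans (All.lookup inColumn c∈X) (sym (All.lookup inColumn d∈X))
  ... | no notInColumn with find (¬All⇒Any¬ (λ c → proj₂ c ≟B proj₂ a) X notInColumn)
  ... | c , c∈X , c₂≢a₂ = inj₁ λ d∈X e∈X → trans (inRowOf-a d∈X) (sym (inRowOf-a e∈X))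
    where
    c₁≡a₁ : proj₁ c ≡ proj₁ a
    c₁≡a₁ with aligned c∈X (here refl)
    ... | inj₁ e = e
    ... | inj₂ e = ⊥-elim (c₂≢a₂ e)

    inRowOf-a : ∀ {d} → d ∈ X → proj₁ d ≡ proj₁ a
    inRowOf-a d∈X with aligned d∈X (here refl) | aligned d∈X c∈X
    ... | inj₁ d₁≡a₁ | _              = d₁≡a₁
    ... | inj₂ _     | inj₁ d₁≡c₁     = trans d₁≡c₁ c₁≡a₁
    ... | inj₂ d₂≡a₂ | inj₂ d₂≡c₂     = ⊥-elim (c₂≢a₂ (trans (sym d₂≡c₂) d₂≡a₂))

module _ {n m : ℕ} where

  length≤-ofAllSame₂ : ∀ {X : List (Fin n × Fin m)} → Unique X → AllSame proj₂ X → length X ≤ n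
  length≤-ofAllSame₂ uniq same = length≤-ofInjectiveOn proj₁ uniq λ a∈X b∈X a₁≡b₁ → cong₂ _,_ a₁≡b₁ (same a∈X b∈X)

  length≤-ofAllSame₁ : ∀ {X : List (Fin n × Fin m)} → Unique X → AllSame proj₁ X → length X ≤ m
  length≤-ofAllSame₁ uniq same = length≤-ofInjectiveOn proj₂ uniq λ a∈X b∈X a₂≡b₂ → cong₂ _,_ (same a∈X b∈X) a₂≡b₂

  length≤-ofPairwiseAligned : ∀ {X : List (Fin n × Fin m)} → Unique X → PairwiseAligned X → length X ≤ n ⊔ m
  length≤-ofPairwiseAligned {X} uniq aligned with pairwiseAligned⇒collinear _≟_ X aligned
  ... | inj₁ sameRow    = ≤-trans (length≤-ofAllSame₁ uniq sameRow) (m≤n⊔m n m)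
  ... | inj₂ sameColumn = ≤-trans (length≤-ofAllSame₂ uniq sameColumn) (m≤m⊔n n m)

module _ (G : Graph) (X : List (V G)) where

  visible-refl : ∀ x → Visible G X x x
  visible-refl x = 0 , [] , (λ _ _ → z≤n) , λ { _ here-nil _ → inj₁ refl }

  visible-ofAdjacent : ∀ {x y} → x ≢ y → Adj G x y → Visible G X x y
  visible-ofAdjacent {x} {y} x≢y e = 1 , e ∷ [] , shortest , endpointsOnly
    where
    shortest : IsShortest G (e ∷ [])
    shortest _ []      = ⊥-elim (x≢y refl)
    shortest _ (_ ∷ _) = s≤s z≤n

    endpointsOnly : ∀ v → OnWalk G v (e ∷ []) → v ∈ X → v ≡ x ⊎ v ≡ y
    endpointsOnly _ (here-cons _ _)    _ = inj₁ refl
    endpointsOnly _ (there _ here-nil) _ = inj₂ refl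

  visible-via : ∀ {x z y} (e : Adj G x z) (e′ : Adj G z y) → z ∉ X →
                (∀ k → Walk G x y k → 2 ≤ k) → Visible G X x y
  visible-via {x} {z} {y} e e′ z∉X distance≥2 = 2 , e ∷ e′ ∷ [] , distance≥2 , endpointsOnly
    where
    endpointsOnly : ∀ v → OnWalk G v (e ∷ e′ ∷ []) → v ∈ X → v ≡ x ⊎ v ≡ y
    endpointsOnly _ (here-cons _ _)               _   = inj₁ refl
    endpointsOnly _ (there _ (here-cons _ _))     z∈X = ⊥-elim (z∉X z∈X)
    endpointsOnly _ (there _ (there _ here-nil))  _   = inj₂ refl

module _ {n m : ℕ} where

  private
    Rook : Graph
    Rook = K n □ K m

    Vertex : Set
    Vertex = Fin n × Fin m

    open DecMembership (≡-dec (_≟_ {n}) (_≟_ {m})) using (_∈?_)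

  corner : Vertex → Vertex → Vertex
  corner x y = proj₁ x , proj₂ y

  corners-notAligned : ∀ {x y} → ¬ Aligned x y → ¬ Aligned (corner x y) (corner y x)
  corners-notAligned notAligned (inj₁ x₁≡y₁) = notAligned (inj₁ x₁≡y₁)
  corners-notAligned notAligned (inj₂ y₂≡x₂) = notAligned (inj₂ (sym y₂≡x₂))

  walk-length≥2 : ∀ {x y k} → ¬ Aligned x y → Walk Rook x y k → 2 ≤ k
  walk-length≥2 notAligned []                   = ⊥-elim (notAligned (inj₁ refl))
  walk-length≥2 notAligned (inj₁ (_ , e) ∷ [])  = ⊥-elim (notAligned (inj₂ e))
  walk-length≥2 notAligned (inj₂ (e , _) ∷ [])  = ⊥-elim (notAligned (inj₁ e))
  walk-length≥2 notAligned (_ ∷ _ ∷ _)          = s≤s (s≤s z≤n)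

  shortWalk-visitsCorner : ∀ {x y k} → ¬ Aligned x y → (W : Walk Rook x y k) → k ≤ 2 →
                           OnWalk Rook (corner x y) W ⊎ OnWalk Rook (corner y x) W
  shortWalk-visitsCorner notAligned (inj₁ (_ , refl) ∷ inj₂ (refl , _) ∷ []) _ = inj₂ (there _ (here-cons _ []))
  shortWalk-visitsCorner notAligned (inj₂ (refl , _) ∷ inj₁ (_ , refl) ∷ []) _ = inj₁ (there _ (here-cons _ []))
  shortWalk-visitsCorner notAligned (inj₁ (_ , x₂≡z₂) ∷ inj₁ (_ , z₂≡y₂) ∷ []) _ =
    ⊥-elim (notAligned (inj₂ (trans x₂≡z₂ z₂≡y₂)))
  shortWalk-visitsCorner notAligned (inj₂ (x₁≡z₁ , _) ∷ inj₂ (z₁≡y₁ , _) ∷ []) _ =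
    ⊥-elim (notAligned (inj₁ (trans x₁≡z₁ z₁≡y₁)))
  shortWalk-visitsCorner notAligned []                  _ = ⊥-elim (notAligned (inj₁ refl))
  shortWalk-visitsCorner notAligned (inj₁ (_ , e) ∷ []) _ = ⊥-elim (notAligned (inj₂ e))
  shortWalk-visitsCorner notAligned (inj₂ (e , _) ∷ []) _ = ⊥-elim (notAligned (inj₁ e))
  shortWalk-visitsCorner notAligned (_ ∷ _ ∷ _ ∷ _) (s≤s (s≤s ()))

  notCorner : ∀ {a b} → ¬ Aligned a b → ¬ (a ≡ corner a b ⊎ a ≡ corner b a)
  notCorner notAligned (inj₁ a≡ab) = notAligned (inj₂ (cong proj₂ a≡ab))
  notCorner notAligned (inj₂ a≡ba) = notAligned (inj₁ (cong proj₁ a≡ba))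

  visible-ofCornersNotBoth : ∀ X x y → (¬ Aligned x y → ¬ (corner x y ∈ X × corner y x ∈ X)) →
                             Visible Rook X x y
  visible-ofCornersNotBoth X x y notBoth with proj₁ x ≟ proj₁ y | proj₂ x ≟ proj₂ y
  ... | yes x₁≡y₁ | yes x₂≡y₂ = subst (Visible Rook X x) (cong₂ _,_ x₁≡y₁ x₂≡y₂) (visible-refl Rook X x)
  ... | yes x₁≡y₁ | no x₂≢y₂ = visible-ofAdjacent Rook X (x₂≢y₂ ∘ cong proj₂) (inj₂ (x₁≡y₁ , x₂≢y₂))
  ... | no x₁≢y₁ | yes x₂≡y₂ = visible-ofAdjacent Rook X (x₁≢y₁ ∘ cong proj₁) (inj₁ (x₁≢y₁ , x₂≡y₂))
  ... | no x₁≢y₁ | no x₂≢y₂ with corner x y ∈? X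
  ...   | no xy∉X = visible-via Rook X (inj₂ (refl , x₂≢y₂)) (inj₁ (x₁≢y₁ , refl)) xy∉X
                      (λ _ → walk-length≥2 [ x₁≢y₁ , x₂≢y₂ ])
  ...   | yes xy∈X = visible-via Rook X (inj₁ (x₁≢y₁ , refl)) (inj₂ (refl , x₂≢y₂))
                       (λ yx∈X → notBoth [ x₁≢y₁ , x₂≢y₂ ] (xy∈X , yx∈X))
                       (λ _ → walk-length≥2 [ x₁≢y₁ , x₂≢y₂ ])

  pairwiseAligned⇒totalMutualVisibility : ∀ {X} → Unique X → PairwiseAligned X → TotalMutualVisibility Rook X
  pairwiseAligned⇒totalMutualVisibility {X} uniq aligned = uniq , λ x y →
    visible-ofCornersNotBoth X x y λ notAligned (xy∈X , yx∈X) → corners-notAligned notAligned (aligned xy∈X yx∈X)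

  -- The corners of the pair (corner a b , corner b a) are a and b themselves (η for pairs).
  totalMutualVisibility⇒pairwiseAligned : ∀ {X} → TotalMutualVisibility Rook X → PairwiseAligned X
  totalMutualVisibility⇒pairwiseAligned (_ , visible) {a} {b} a∈X b∈X
    with proj₁ a ≟ proj₁ b ⊎-dec proj₂ a ≟ proj₂ b
  ... | yes aligned = aligned
  ... | no notAligned with visible (corner a b) (corner b a)
  ... | _ , W , shortest , endpointsOnly
    with shortWalk-visitsCorner (corners-notAligned notAligned) W (shortest 2 throughA)
    where
    throughA : Walk Rook (corner a b) (corner b a) 2
    throughA = inj₂ (refl , notAligned ∘ inj₂ ∘ sym) ∷ inj₁ (notAligned ∘ inj₁ , refl) ∷ []
  ... | inj₁ a∈W = ⊥-elim (notCorner notAligned (endpointsOnly a a∈W a∈X))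
  ... | inj₂ b∈W = ⊥-elim (notCorner (notAligned ∘ aligned-sym) (swap (endpointsOnly b b∈W b∈X)))

  column : Fin m → List Vertex
  column j = tabulate (_, j)

  column-unique : ∀ j → Unique (column j)
  column-unique j = tabulate⁺ (cong proj₁)

  column-pairwiseAligned : ∀ j → PairwiseAligned (column j)
  column-pairwiseAligned j a∈ b∈ with ∈-tabulate⁻ a∈ | ∈-tabulate⁻ b∈
  ... | _ , refl | _ , refl = inj₂ refl

  row : Fin n → List Vertex
  row i = tabulate (i ,_)

  row-unique : ∀ i → Unique (row i)
  row-unique i = tabulate⁺ (cong proj₂)

  row-pairwiseAligned : ∀ i → PairwiseAligned (row i)
  row-pairwiseAligned i a∈ b∈ with ∈-tabulate⁻ a∈ | ∈-tabulate⁻ b∈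
  ... | _ , refl | _ , refl = inj₁ refl

  maximum-attained : Fin n → Fin m → ∃[ X ] (TotalMutualVisibility Rook X × length X ≡ n ⊔ m)
  maximum-attained i j with ≤-total m n
  ... | inj₁ m≤n = column j , pairwiseAligned⇒totalMutualVisibility (column-unique j) (column-pairwiseAligned j)
                 , trans (length-tabulate (_, j)) (sym (m≥n⇒m⊔n≡m m≤n))
  ... | inj₂ n≤m = row i , pairwiseAligned⇒totalMutualVisibility (row-unique i) (row-pairwiseAligned i)
                 , trans (length-tabulate (i ,_)) (sym (m≤n⇒m⊔n≡n n≤m))

proposition4p3 : ∀ (n m : ℕ) → 2 ≤ n → 2 ≤ m → IsMuT (K n □ K m) (n ⊔ m)
proposition4p3 _ _ (s≤s _) (s≤s _) =
  maximum-attained zero zero ,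
  λ X tmv → length≤-ofPairwiseAligned (proj₁ tmv) (totalMutualVisibility⇒pairwiseAligned tmv)
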